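{- Let $\Delta$ be a labeled hypergraph on $[d]$ and let $k\in[d]$ belong to some edge of Type $0$ of $\Delta$. Then there is a bijection, preserving both the weak order and the rank, between the set of matroids $N$ on $[d]$ with $N\preceq\Delta$ and the set of matroids $N'$ on $[d]\setminus\{k\}$ with $N'\preceq\Delta\setminus\{k\}$.
   Context: Fix $n$. A labeled hypergraph $\Delta$ on a finite set $E$ is a collection of subsets of $E$ (edges), each labeled with a Type $i\in\{0,\dots,n-1\}$, such that no two edges of the same type are properly contained in one another and each edge of Type $i$ has at least $i+1$ elements; $\Delta_i$ denotes the edges of Type $i$. For a matroid $N$ on $E$, $N\preceq\Delta$ means $\mathrm{rank}_N(e)\le i$ for all $e\in\Delta_i$ and all $i$. For $k\in[d]$, $\Delta\setminus\{k\}$ is the labeled hypergraph on $[d]\setminus\{k\}$ whose edges of Type $i$ are the sets $e\setminus\{k\}$ with $e\in\Delta_i$ and $|e\setminus\{k\}|\ge i+1$. Weak order: $N_2\le N_1$ iff every dependent set of $N_1$ is dependent in $N_2$. -}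

module Defs where

open import Level using (0ℓ) renaming (suc to lsuc)
open import Data.Nat using (ℕ; suc; _≤_; _<_)
open import Data.Fin using (Fin; toℕ)
open import Data.Fin.Subset using (Subset; _⊆_; _∈_; _∉_; ∣_∣; ⊥; ⊤; ⁅_⁆; _∪_; _─_)
open import Data.Product using (Σ; ∃; _×_; _,_; proj₁)
open import Relation.Nullary using (¬_)
open import Relation.Binary.PropositionalEquality using (_≡_)
open import Relation.Binary.Bundles using (Setoid)
open import Function.Bundles using (_⇔_; Equivalence)
open import Function.Properties.Equivalence using (⇔-isEquivalence)
open import Relation.Binary.Structures using (IsEquivalence)

record Matroid (d : ℕ) (E : Subset d) : Set₁ where
  field
    Indep      : Subset d → Set
    indep⊆E    : ∀ {I} → Indep I → I ⊆ E
    indep-∅    : Indep ⊥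
    indep-down : ∀ {I J} → J ⊆ I → Indep I → Indep J
    indep-aug  : ∀ {I J} → Indep I → Indep J → ∣ I ∣ < ∣ J ∣ →
                 ∃ λ x → x ∈ J × x ∉ I × Indep (I ∪ ⁅ x ⁆)
open Matroid public

module _ {d : ℕ} {E : Subset d} where

  RankAtMost : Matroid d E → Subset d → ℕ → Set
  RankAtMost N X r = ∀ I → I ⊆ X → Indep N I → ∣ I ∣ ≤ r

  HasRank : Matroid d E → Subset d → ℕ → Set
  HasRank N X r = (∃ λ I → I ⊆ X × Indep N I × ∣ I ∣ ≡ r) × RankAtMost N X r

  MatroidRank : Matroid d E → ℕ → Set
  MatroidRank N r = HasRank N E r

  Dependent : Matroid d E → Subset d → Set
  Dependent N X = X ⊆ E × ¬ Indep N X

  _≤w_ : Matroid d E → Matroid d E → Set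
  N₂ ≤w N₁ = ∀ X → Dependent N₁ X → Dependent N₂ X

  _≈M_ : Matroid d E → Matroid d E → Set
  N ≈M N' = ∀ X → Indep N X ⇔ Indep N' X

-- A (raw) labeled hypergraph with types in {0,…,n-1} on subsets of [d]:
-- Edges i e  means  e is an edge of Type i, i.e. e ∈ Δ_i.
Hypergraph : ℕ → ℕ → Set₁
Hypergraph n d = Fin n → Subset d → Set

record IsLabeledHypergraph {n d : ℕ} (E : Subset d) (Δ : Hypergraph n d) : Set where
  field
    edge⊆E    : ∀ {i e} → Δ i e → e ⊆ E
    edge-size : ∀ {i e} → Δ i e → suc (toℕ i) ≤ ∣ e ∣
    antichain : ∀ {i e f} → Δ i e → Δ i f → e ⊆ f → e ≡ f

_⪯_ : {n d : ℕ} {E : Subset d} → Matroid d E → Hypergraph n d → Set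
N ⪯ Δ = ∀ i e → Δ i e → RankAtMost N e (toℕ i)

_∖ground_ : {d : ℕ} → Subset d → Fin d → Subset d
E ∖ground k = E ─ ⁅ k ⁆

_∖H_ : {n d : ℕ} → Hypergraph n d → Fin d → Hypergraph n d
(Δ ∖H k) i f = ∃ λ e → Δ i e × f ≡ e ─ ⁅ k ⁆ × suc (toℕ i) ≤ ∣ f ∣

MatroidsBelow : {n d : ℕ} (E : Subset d) → Hypergraph n d → Setoid (lsuc 0ℓ) 0ℓ
MatroidsBelow {d = d} E Δ = record
  { Carrier = Σ (Matroid d E) (λ N → N ⪯ Δ)
  ; _≈_ = λ A B → proj₁ A ≈M proj₁ B
  ; isEquivalence = record
      { refl  = λ X → IsEquivalence.refl ⇔-isEquivalence
      ; sym   = λ p X → IsEquivalence.sym ⇔-isEquivalence (p X)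
      ; trans = λ p q X → IsEquivalence.trans ⇔-isEquivalence (p X) (q X) }
  }

{-# OPTIONS --safe #-}
-- Since k lies in an edge of Type 0, the set {k} has rank 0 in every N ⪯ Δ:
-- k is a loop, so no independent set of N contains k.  The independent sets of
-- N therefore also form a matroid on [d] ∖ {k}, and rank and weak order depend
-- only on the independent sets.  The conditions correspond because deleting a
-- loop from an edge does not change its rank, while an edge e of Type i with
-- |e ∖ {k}| ≤ i imposes no condition at all.
module Submission where

open import Defs
open import Data.Nat using (ℕ; suc; _≤_; _≤?_)
open import Data.Nat.Properties using (≤-trans; ≤-pred; ≰⇒>; 1+n≰n)
open import Data.Fin using (Fin; toℕ)
open import Data.Fin.Subset using (Subset; ⊤; ⁅_⁆; _─_; _∈_; _∉_; _⊆_; ∣_∣; inside; outside)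
open import Data.Fin.Subset.Properties using (x∈⁅x⁆; x∈⁅y⁆⇒x≡y; ∣⁅x⁆∣≡1; p⊆q⇒∣p∣≤∣q∣; ∈⊤)
open import Data.Vec.Base using (_∷_; here; there)
open import Data.Product using (Σ; ∃; _×_; _,_; proj₁; proj₂)
open import Relation.Nullary using (¬_; Dec; yes; no; contradiction)
open import Relation.Binary.PropositionalEquality using (_≡_; refl; sym; subst)
open import Relation.Binary.Bundles using (Setoid)
open import Function.Base using (id; _∘_)
open import Function.Bundles using (Bijection; _⇔_; mk⇔)
import Function.Properties.Equivalence as ⇔

private
  variable
    d : ℕ
    x k : Fin d
    p q : Subset d

x∈p─q⁺ : x ∈ p → x ∉ q → x ∈ p ─ q
x∈p─q⁺ {q = outside ∷ _} here        x∉q = here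
x∈p─q⁺ {q = inside ∷ _}  here        x∉q = contradiction here x∉q
x∈p─q⁺ {q = _ ∷ _}       (there x∈p) x∉q = there (x∈p─q⁺ x∈p (x∉q ∘ there))

x∈p─q⇒x∈p : x ∈ p ─ q → x ∈ p
x∈p─q⇒x∈p {p = _ ∷ _} {q = outside ∷ _} here       = here
x∈p─q⇒x∈p {p = _ ∷ _} {q = _ ∷ _}       (there x∈) = there (x∈p─q⇒x∈p x∈)

x∈p─q⇒x∉q : x ∈ p ─ q → x ∉ q
x∈p─q⇒x∉q {p = _ ∷ _} {q = outside ∷ _} here       ()
x∈p─q⇒x∉q {p = _ ∷ _} {q = _ ∷ _}       (there x∈) (there x∈q) = x∈p─q⇒x∉q x∈ x∈q

∈⇒⁅⁆⊆ : x ∈ p → ⁅ x ⁆ ⊆ p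
∈⇒⁅⁆⊆ {x = x} {p = p} x∈p y∈⁅x⁆ = subst (_∈ p) (sym (x∈⁅y⁆⇒x≡y x y∈⁅x⁆)) x∈p

⊆∧∉⇒⊆─⁅⁆ : p ⊆ q → k ∉ p → p ⊆ q ─ ⁅ k ⁆
⊆∧∉⇒⊆─⁅⁆ {k = k} p⊆q k∉p x∈p =
  x∈p─q⁺ (p⊆q x∈p) (λ x∈⁅k⁆ → k∉p (subst (_∈ _) (x∈⁅y⁆⇒x≡y k x∈⁅k⁆) x∈p))

-- Weak order and rank in terms of independent sets alone, so that they do not
-- see the ground set; ¬ ¬ appears because dependence is only the negation of
-- independence.
_≤wⁱ_ : {E E′ : Subset d} → Matroid d E → Matroid d E′ → Set
N₂ ≤wⁱ N₁ = ∀ X → Indep N₂ X → ¬ ¬ Indep N₁ X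

MaxIndepSize : {E : Subset d} → Matroid d E → ℕ → Set
MaxIndepSize N r = (∃ λ I → Indep N I × ∣ I ∣ ≡ r) × (∀ I → Indep N I → ∣ I ∣ ≤ r)

module _ {E : Subset d} where

  Loop : Matroid d E → Fin d → Set
  Loop N k = RankAtMost N ⁅ k ⁆ 0

  loop∉indep : (N : Matroid d E) → Loop N k → ∀ {I} → Indep N I → k ∉ I
  loop∉indep {k = k} N loop indI k∈I =
    1+n≰n (subst (_≤ 0) (∣⁅x⁆∣≡1 k) (loop ⁅ k ⁆ id (indep-down N (∈⇒⁅⁆⊆ k∈I) indI)))

  ⪯⇒loop : {n : ℕ} {Δ : Hypergraph n d} (N : Matroid d E) → N ⪯ Δ →
           (∃ λ i → toℕ i ≡ 0 × (∃ λ e → Δ i e × k ∈ e)) → Loop N k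
  ⪯⇒loop N N⪯Δ (i , i≡0 , e , Δie , k∈e) J J⊆⁅k⁆ indJ =
    subst (∣ J ∣ ≤_) i≡0 (N⪯Δ i e Δie J (∈⇒⁅⁆⊆ k∈e ∘ J⊆⁅k⁆) indJ)

  loop⇒indep⊆∖ground : (N : Matroid d E) → Loop N k → ∀ {I} → Indep N I → I ⊆ E ∖ground k
  loop⇒indep⊆∖ground N loop indI = ⊆∧∉⇒⊆─⁅⁆ (indep⊆E N indI) (loop∉indep N loop indI)

  ≤w⇔≤wⁱ : (N₁ N₂ : Matroid d E) → N₂ ≤w N₁ ⇔ N₂ ≤wⁱ N₁
  ≤w⇔≤wⁱ N₁ N₂ = mk⇔ to from
    where
    to : N₂ ≤w N₁ → N₂ ≤wⁱ N₁
    to N₂≤N₁ X indX₂ ¬indX₁ = proj₂ (N₂≤N₁ X (indep⊆E N₂ indX₂ , ¬indX₁)) indX₂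
    from : N₂ ≤wⁱ N₁ → N₂ ≤w N₁
    from N₂≤N₁ X (X⊆E , ¬indX₁) = X⊆E , λ indX₂ → N₂≤N₁ X indX₂ ¬indX₁

  MatroidRank⇔MaxIndepSize : (N : Matroid d E) (r : ℕ) → MatroidRank N r ⇔ MaxIndepSize N r
  MatroidRank⇔MaxIndepSize N r = mk⇔ to from
    where
    to : MatroidRank N r → MaxIndepSize N r
    to ((I , _ , indI , ∣I∣≡r) , maximal) =
      (I , indI , ∣I∣≡r) , λ J indJ → maximal J (indep⊆E N indJ) indJ
    from : MaxIndepSize N r → MatroidRank N r
    from ((I , indI , ∣I∣≡r) , maximal) =
      (I , indep⊆E N indI , indI , ∣I∣≡r) , λ J _ indJ → maximal J indJ

module _ {E E′ : Subset d} where

  reground : (N : Matroid d E) → (∀ {I} → Indep N I → I ⊆ E′) → Matroid d E′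
  reground N indep⊆E′ = record
    { Indep      = Indep N
    ; indep⊆E    = indep⊆E′
    ; indep-∅    = indep-∅ N
    ; indep-down = indep-down N
    ; indep-aug  = indep-aug N
    }

  reground-≤w : (N₁ N₂ : Matroid d E) (h₁ : ∀ {I} → Indep N₁ I → I ⊆ E′)
                (h₂ : ∀ {I} → Indep N₂ I → I ⊆ E′) →
                N₂ ≤w N₁ ⇔ reground N₂ h₂ ≤w reground N₁ h₁
  reground-≤w N₁ N₂ h₁ h₂ =
    ⇔.trans (≤w⇔≤wⁱ N₁ N₂) (⇔.sym (≤w⇔≤wⁱ (reground N₁ h₁) (reground N₂ h₂)))

  reground-rank : (N : Matroid d E) (h : ∀ {I} → Indep N I → I ⊆ E′) (r : ℕ) →
                  MatroidRank N r ⇔ MatroidRank (reground N h) r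
  reground-rank N h r =
    ⇔.trans (MatroidRank⇔MaxIndepSize N r) (⇔.sym (MatroidRank⇔MaxIndepSize (reground N h) r))

module _ {n : ℕ} {E : Subset d} {Δ : Hypergraph n d} (N : Matroid d E) where

  ⪯⇒⪯∖H : N ⪯ Δ → N ⪯ (Δ ∖H k)
  ⪯⇒⪯∖H N⪯Δ i _ (e , Δie , refl , _) I I⊆e─k = N⪯Δ i e Δie I (x∈p─q⇒x∈p ∘ I⊆e─k)

  -- An edge e of Type i with no counterpart in Δ ∖H k has |e ∖ {k}| ≤ i,
  -- so it bounds the rank trivially.
  ⪯∖H⇒⪯ : (∀ {I} → Indep N I → k ∉ I) → N ⪯ (Δ ∖H k) → N ⪯ Δ
  ⪯∖H⇒⪯ {k = k} k∉indep N⪯Δ∖k i e Δie I I⊆e indI = bound (suc (toℕ i) ≤? ∣ e ─ ⁅ k ⁆ ∣)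
    where
    I⊆e─k : I ⊆ e ─ ⁅ k ⁆
    I⊆e─k = ⊆∧∉⇒⊆─⁅⁆ I⊆e (k∉indep indI)
    bound : Dec (suc (toℕ i) ≤ ∣ e ─ ⁅ k ⁆ ∣) → ∣ I ∣ ≤ toℕ i
    bound (yes large) = N⪯Δ∖k i (e ─ ⁅ k ⁆) (e , Δie , refl , large) I I⊆e─k indI
    bound (no small)  = ≤-trans (p⊆q⇒∣p∣≤∣q∣ I⊆e─k) (≤-pred (≰⇒> small))

∉indep-∖ground : (N : Matroid d (⊤ ∖ground k)) → ∀ {I} → Indep N I → k ∉ I
∉indep-∖ground {k = k} N indI k∈I = x∈p─q⇒x∉q (indep⊆E N indI k∈I) (x∈⁅x⁆ k)

lemma3p24 : {n d : ℕ} (Δ : Hypergraph n d) → IsLabeledHypergraph ⊤ Δ →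
              (k : Fin d) → (∃ λ i → toℕ i ≡ 0 × (∃ λ e → Δ i e × k ∈ e)) →
              Σ (Bijection (MatroidsBelow ⊤ Δ) (MatroidsBelow (⊤ ∖ground k) (Δ ∖H k)))
                λ φ →
                  (∀ N₁ N₂ → (proj₁ N₂ ≤w proj₁ N₁) ⇔ (proj₁ (Bijection.to φ N₂) ≤w proj₁ (Bijection.to φ N₁)))
                  × (∀ N r → MatroidRank (proj₁ N) r ⇔ MatroidRank (proj₁ (Bijection.to φ N)) r)
lemma3p24 Δ _ k k∈type0 = φ , weak , rank
  where
  loop-free : (N : Matroid _ ⊤) → N ⪯ Δ → ∀ {I} → Indep N I → I ⊆ ⊤ ∖ground k
  loop-free N N⪯Δ = loop⇒indep⊆∖ground N (⪯⇒loop N N⪯Δ k∈type0)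
  delete : Setoid.Carrier (MatroidsBelow ⊤ Δ) → Setoid.Carrier (MatroidsBelow (⊤ ∖ground k) (Δ ∖H k))
  delete (N , N⪯Δ) = reground N (loop-free N N⪯Δ) , ⪯⇒⪯∖H N N⪯Δ
  undelete : Setoid.Carrier (MatroidsBelow (⊤ ∖ground k) (Δ ∖H k)) → Setoid.Carrier (MatroidsBelow ⊤ Δ)
  undelete (N , N⪯Δ∖k) = reground N (λ _ _ → ∈⊤) , ⪯∖H⇒⪯ N (∉indep-∖ground N) N⪯Δ∖k
  φ : Bijection (MatroidsBelow ⊤ Δ) (MatroidsBelow (⊤ ∖ground k) (Δ ∖H k))
  φ = record { to = delete ; cong = id ; bijective = id , λ N → undelete N , id }
  weak : ∀ N₁ N₂ → (proj₁ N₂ ≤w proj₁ N₁) ⇔ (proj₁ (delete N₂) ≤w proj₁ (delete N₁))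
  weak (N₁ , N₁⪯Δ) (N₂ , N₂⪯Δ) = reground-≤w N₁ N₂ (loop-free N₁ N₁⪯Δ) (loop-free N₂ N₂⪯Δ)
  rank : ∀ N r → MatroidRank (proj₁ N) r ⇔ MatroidRank (proj₁ (delete N)) r
  rank (N , N⪯Δ) = reground-rank N (loop-free N N⪯Δ)
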